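{- Let $G$ be a graph and $M\subseteq V(G)$ a modulator of $G$. Suppose that a vertex $v\in M$ and two vertices $u,w$ of the same connected component $C$ of $G-M$ form a triangle $uvw$ in $G$. Then every neighbor of $v$ lies in $M\cup V(C)$.
   Context: All graphs are finite, simple and undirected. A paw is the four-vertex graph consisting of a triangle together with one additional vertex adjacent to exactly one vertex of the triangle. A set $M\subseteq V(G)$ is a modulator of $G$ if every vertex set $F\subseteq V(G)$ inducing a paw in $G$ satisfies $|F\cap M|\ge 2$. $G-M$ denotes the subgraph induced by $V(G)\setminus M$. -}

module Defs where

open import Data.Nat using (ℕ; _≤_)
open import Data.Bool using (Bool; true; false)
open import Data.Fin using (Fin)
open import Data.Fin.Subset using (Subset; _∈_; _∉_; ⁅_⁆; _∪_; _∩_; ∣_∣)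
open import Relation.Binary.PropositionalEquality using (_≡_; _≢_)
open import Relation.Nullary using (¬_)

record Graph (n : ℕ) : Set where
  field
    adj       : Fin n → Fin n → Bool
    adj-sym   : ∀ x y → adj x y ≡ adj y x
    adj-irref : ∀ x → adj x x ≡ false

open Graph public

Adj : ∀ {n} → Graph n → Fin n → Fin n → Set
Adj G x y = adj G x y ≡ true

InducedPaw : ∀ {n} → Graph n → Fin n → Fin n → Fin n → Fin n → Set
InducedPaw G a b c d =
  a ≢ b × a ≢ c × a ≢ d × b ≢ c × b ≢ d × c ≢ d ×
  Adj G a b × Adj G b c × Adj G a c ×
  Adj G d a × ¬ Adj G d b × ¬ Adj G d c
  where open import Data.Product using (_×_)

quad : ∀ {n} → Fin n → Fin n → Fin n → Fin n → Subset n
quad a b c d = ⁅ a ⁆ ∪ ⁅ b ⁆ ∪ ⁅ c ⁆ ∪ ⁅ d ⁆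

-- M is a modulator: every vertex set F inducing a paw has |F ∩ M| ≥ 2.
-- (Any set inducing a paw is {a,b,c,d} for some labelling as in InducedPaw.)
IsModulator : ∀ {n} → Graph n → Subset n → Set
IsModulator {n} G M =
  ∀ (a b c d : Fin n) → InducedPaw G a b c d → 2 ≤ ∣ quad a b c d ∩ M ∣

-- Connectivity in G - M: ConnOut G M x y holds iff x and y are vertices of
-- G - M lying in the same connected component of G - M.
data ConnOut {n} (G : Graph n) (M : Subset n) (x : Fin n) : Fin n → Set where
  here : x ∉ M → ConnOut G M x x
  step : ∀ {y z} → ConnOut G M x y → Adj G y z → z ∉ M → ConnOut G M x z

module Submission where

open import Defs
open import Data.Bool using (true)
import Data.Bool.Properties as Bool
open import Data.Empty using (⊥-elim)
open import Data.Fin using (Fin)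
open import Data.Fin.Subset using (Subset; _∈_; _∉_; ⁅_⁆; _∩_; ∣_∣; _⊆_)
open import Data.Fin.Subset.Properties
  using (_∈?_; x∈⁅y⁆⇒x≡y; ∣⁅x⁆∣≡1; p⊆q⇒∣p∣≤∣q∣; x∈p∪q⁻; x∈p∩q⁻)
open import Data.Nat using (_≤_)
open import Data.Nat.Properties using (≤-trans; ≤-reflexive; ≤⇒≯)
open import Data.Product using (_,_)
open import Data.Sum using (_⊎_; inj₁; inj₂)
open import Relation.Nullary using (¬_; yes; no)
open import Relation.Binary.PropositionalEquality using (_≡_; _≢_; refl; sym; trans; subst)

-- A neighbour x of v outside M that is adjacent to u or w joins their
-- component. Otherwise {v, u, w, x} induces a paw (triangle vuw, pendant x
-- at v) whose only possible vertex in M is v, contradicting the modulator.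

module _ {n} (G : Graph n) where

  Adj-sym : ∀ {x y} → Adj G x y → Adj G y x
  Adj-sym {x} {y} xy = trans (adj-sym G y x) xy

  Adj⇒≢ : ∀ {x y} → Adj G x y → x ≢ y
  Adj⇒≢ {x} xx refl with trans (sym xx) (adj-irref G x)
  ... | ()

  Adj-respˡ-≡ : ∀ {x y z} → x ≡ y → Adj G x z → Adj G y z
  Adj-respˡ-≡ refl xz = xz

module _ {n} {G : Graph n} {M : Subset n} where

  ConnOut-source∉ : ∀ {x y} → ConnOut G M x y → x ∉ M
  ConnOut-source∉ (here x∉M)   = x∉M
  ConnOut-source∉ (step c _ _) = ConnOut-source∉ c

  ConnOut-target∉ : ∀ {x y} → ConnOut G M x y → y ∉ M
  ConnOut-target∉ (here y∉M)     = y∉M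
  ConnOut-target∉ (step _ _ y∉M) = y∉M

quad∩⊆⁅first⁆ : ∀ {n} (M : Subset n) {a b c d} → b ∉ M → c ∉ M → d ∉ M →
  quad a b c d ∩ M ⊆ ⁅ a ⁆
quad∩⊆⁅first⁆ M {a} {b} {c} {d} b∉M c∉M d∉M y∈ with x∈p∩q⁻ (quad a b c d) M y∈
... | y∈quad , y∈M with x∈p∪q⁻ ⁅ a ⁆ _ y∈quad
...   | inj₁ y∈a = y∈a
...   | inj₂ y∈bcd with x∈p∪q⁻ ⁅ b ⁆ _ y∈bcd
...     | inj₁ y∈b = ⊥-elim (b∉M (subst (_∈ M) (x∈⁅y⁆⇒x≡y b y∈b) y∈M))
...     | inj₂ y∈cd with x∈p∪q⁻ ⁅ c ⁆ _ y∈cd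
...       | inj₁ y∈c = ⊥-elim (c∉M (subst (_∈ M) (x∈⁅y⁆⇒x≡y c y∈c) y∈M))
...       | inj₂ y∈d = ⊥-elim (d∉M (subst (_∈ M) (x∈⁅y⁆⇒x≡y d y∈d) y∈M))

IsModulator⇒¬InducedPaw : ∀ {n} (G : Graph n) (M : Subset n) → IsModulator G M →
  ∀ {a b c d} → b ∉ M → c ∉ M → d ∉ M → ¬ InducedPaw G a b c d
IsModulator⇒¬InducedPaw G M mod {a} {b} {c} {d} b∉M c∉M d∉M paw =
  ≤⇒≯ ∣quad∩M∣≤1 (mod a b c d paw)
  where
  ∣quad∩M∣≤1 : ∣ quad a b c d ∩ M ∣ ≤ 1
  ∣quad∩M∣≤1 = ≤-trans (p⊆q⇒∣p∣≤∣q∣ (quad∩⊆⁅first⁆ M {a} b∉M c∉M d∉M))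
                       (≤-reflexive (∣⁅x⁆∣≡1 a))

triangle-pendant⇒InducedPaw : ∀ {n} (G : Graph n) {v u w x : Fin n} →
  Adj G u v → Adj G v w → Adj G u w → Adj G v x → ¬ Adj G x u → ¬ Adj G x w →
  InducedPaw G v u w x
triangle-pendant⇒InducedPaw G {v} {u} {w} {x} uv vw uw vx ¬xu ¬xw =
    Adj⇒≢ G {v} vu , Adj⇒≢ G {v} vw , Adj⇒≢ G {v} vx
  , Adj⇒≢ G {u} uw , (λ u≡x → ¬xw (Adj-respˡ-≡ G u≡x uw))
  , (λ w≡x → ¬xu (Adj-respˡ-≡ G w≡x (Adj-sym G {u} uw)))
  , vu , uw , vw
  , Adj-sym G {v} vx , ¬xu , ¬xw
  where
  vu : Adj G v u
  vu = Adj-sym G {u} uv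

proposition5 : ∀ {n} (G : Graph n) (M : Subset n) → IsModulator G M →
    ∀ (v u w : Fin n) → v ∈ M → ConnOut G M u w →
    Adj G u v → Adj G v w → Adj G u w →
    ∀ (x : Fin n) → Adj G v x → x ∈ M ⊎ ConnOut G M u x
proposition5 G M mod v u w _ u~w uv vw uw x vx with x ∈? M
... | yes x∈M = inj₁ x∈M
... | no x∉M with adj G x u Bool.≟ true | adj G x w Bool.≟ true
...   | yes xu | _      = inj₂ (step (here (ConnOut-source∉ u~w)) (Adj-sym G {x} xu) x∉M)
...   | no _   | yes xw = inj₂ (step u~w (Adj-sym G {x} xw) x∉M)
...   | no ¬xu | no ¬xw =
  ⊥-elim (IsModulator⇒¬InducedPaw G M mod {v}
            (ConnOut-source∉ u~w) (ConnOut-target∉ u~w) x∉M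
            (triangle-pendant⇒InducedPaw G uv vw uw vx ¬xu ¬xw))
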